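{- Let $m\geq2$ be an integer and $0<\lambda<\frac2m$. Then for every $p\in D_\lambda$ with $p>\frac{2}{2-\lambda m}$, \[\frac{f_\lambda(p)}{p}\geq m+2-\frac2p.\]
   Context: For a prime $p$ and real $\lambda>0$, $I_\lambda(p)=[p,p+\lambda p]$; $D_\lambda$ is the set of primes $p$ such that $I_\lambda(p)$ contains at least two primes; for $p\in D_\lambda$, $f_\lambda(p)$ is the largest integer that is not a finite sum of primes from $I_\lambda(p)$ (the Frobenius number of the numerical semigroup generated by these primes).
   Formalization: The parameter λ is rational rather than real, in the intervals I_λ(p), the set D_λ and the Frobenius numbers f_λ(p). -}

module Defs where

open import Data.Nat using (ℕ; _≤_)
open import Data.Nat.Primality using (Prime)
open import Data.Integer using (ℤ; +_; _<_)
open import Data.Rational as ℚ using (ℚ; _/_)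
open import Data.List using (List)
open import Data.Nat.ListAction using (sum)
open import Data.List.Relation.Unary.All using (All)
open import Data.Product using (Σ; ∃; _×_)
open import Relation.Binary.PropositionalEquality using (_≡_; _≢_)
open import Relation.Nullary using (¬_)

ℕtoℚ : ℕ → ℚ
ℕtoℚ n = + n / 1

InI : ℚ → ℕ → ℕ → Set
InI lam p q = Prime q × (p ≤ q) × (ℕtoℚ q ℚ.≤ ℕtoℚ p ℚ.+ lam ℚ.* ℕtoℚ p)

InD : ℚ → ℕ → Set
InD lam p = Prime p × ∃ λ q₁ → ∃ λ q₂ → q₁ ≢ q₂ × InI lam p q₁ × InI lam p q₂

Representable : ℚ → ℕ → ℤ → Set
Representable lam p n = ∃ λ (xs : List ℕ) → All (InI lam p) xs × (n ≡ + sum xs)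

IsFrobeniusNumber : ℚ → ℕ → ℤ → Set
IsFrobeniusNumber lam p F =
  ¬ Representable lam p F × (∀ (n : ℤ) → F < n → Representable lam p n)

module Submission where

-- The idea is to exhibit the non-representable integer N = (m+2)p − 2.
-- Write a candidate representation of N as a sum of k primes from
-- I_λ(p) = [p, p + λp] and split on k:
--   * k ≤ m: the sum is at most m(p + λp), which is smaller than N by the
--     "gap condition" m(p + λp) + 2 < (m+2)p, a rearrangement of p(2 − λm) > 2;
--   * k = m + 1: for p odd all primes in I_λ(p) are odd, so the sum has the
--     parity of m + 1, whereas N = (m+2)p − 2 has the parity of m;
--   * k ≥ m + 2: the sum is at least (m+2)p > N.
-- The prime p = 2 does not occur: there p(2 − λm) > 2 forces 2λ < 1, so
-- I_λ(2) contains only the prime 2.  Hence f_λ(p) ≥ N, which is the claim.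

open import Defs
open import Data.Nat as ℕ using (ℕ; _≤_; _+_; s≤s; z≤n)
open import Data.Nat.Properties using (≤-trans)
open import Data.Nat.Primality using (Prime; prime⇒nonZero)
open import Data.Integer using (ℤ; +_)
open import Data.Rational as ℚ using (ℚ; _/_; _÷_; 0ℚ; NonZero)

open import Data.Nat using (suc; zero; _*_; _∸_)
import Data.Nat.Properties as ℕ
open import Data.Nat.Primality using (composite; prime⇒¬composite)
open import Data.Nat.Divisibility using (divides)
open import Data.Nat.ListAction using (sum)
import Data.Nat.Tactic.RingSolver as ℕ-Ring
import Data.Integer as ℤ
import Data.Integer.Properties as ℤ
open import Data.Rational using (1ℚ)
open import Data.Rational.Properties
  using ( toℚᵘ-injective; toℚᵘ-fromℚᵘ; toℚᵘ-homo-+; toℚᵘ-homo-*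
        ; toℚᵘ-cancel-≤; toℚᵘ-mono-<; normalize-pos
        ; +-*-commutativeRing; _≟_; <⇒≤; ≤-reflexive; *-zeroˡ
        ; +-monoˡ-<; +-monoʳ-<; +-monoˡ-≤; +-mono-≤
        ; *-monoˡ-<-pos; *-monoʳ-≤-nonNeg; *-monoˡ-≤-nonNeg
        ; *-cancelˡ-<-nonNeg; *-cancelʳ-≤-pos; +-comm
        ; nonNeg+nonNeg⇒nonNeg; nonNeg*nonNeg⇒nonNeg; *-assoc; *-inverseˡ; *-identityʳ
        ; module ≤-Reasoning )
open import Data.Rational.Unnormalised as ℚᵘ using (mkℚᵘ; *≡*; *≤*; *<*)
import Data.Rational.Unnormalised.Properties as ℚᵘ
open import Data.List using ([]; _∷_; length)
open import Data.List.Relation.Unary.All as All using (All; []; _∷_)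
open import Data.Product using (∃; _,_)
open import Data.Sum using (_⊎_; inj₁; inj₂)
open import Data.Empty using (⊥-elim)
open import Relation.Nullary using (¬_; yes; no)
open import Relation.Nullary.Decidable.Core using (dec⇒maybe)
open import Relation.Binary.PropositionalEquality
open import Relation.Binary.Definitions using (tri<; tri≈; tri>)
open import Level using (0ℓ)
open import Tactic.RingSolver using (solve-∀)
import Tactic.RingSolver.Core.AlmostCommutativeRing as ACR

-- ℚ as a ring for the reflective ring solver (closed terms such as
-- ℕtoℚ 2 are treated as constants)
ℚ-ring : ACR.AlmostCommutativeRing 0ℓ 0ℓ
ℚ-ring = ACR.fromCommutativeRing +-*-commutativeRing (λ x → dec⇒maybe (0ℚ ≟ x))

<⇒0<- : ∀ {a b} → a ℚ.< b → 0ℚ ℚ.< b ℚ.- a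
<⇒0<- {a} {b} a<b = subst (ℚ._< b ℚ.- a) (cancel a) (+-monoˡ-< (ℚ.- a) a<b)
  where
  cancel : ∀ a → a ℚ.- a ≡ 0ℚ
  cancel = solve-∀ ℚ-ring

+-cancelˡ-< : ∀ c {a b} → c ℚ.+ a ℚ.< c ℚ.+ b → a ℚ.< b
+-cancelˡ-< c {a} {b} lt = subst₂ ℚ._<_ (cancel c a) (cancel c b) (+-monoʳ-< (ℚ.- c) lt)
  where
  cancel : ∀ c x → ℚ.- c ℚ.+ (c ℚ.+ x) ≡ x
  cancel = solve-∀ ℚ-ring

toℚᵘ-/ : ∀ i n → ℚ.toℚᵘ (i / suc n) ℚᵘ.≃ mkℚᵘ i n
toℚᵘ-/ i n = toℚᵘ-fromℚᵘ (mkℚᵘ i n)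

/1-homo-+ : ∀ i j → (i ℤ.+ j) / 1 ≡ i / 1 ℚ.+ j / 1
/1-homo-+ i j = toℚᵘ-injective (begin
  ℚ.toℚᵘ ((i ℤ.+ j) / 1)               ≈⟨ toℚᵘ-/ (i ℤ.+ j) 0 ⟩
  mkℚᵘ (i ℤ.+ j) 0                     ≈⟨ *≡* (cong (ℤ._* + 1) (sym (cong₂ ℤ._+_ (ℤ.*-identityʳ i) (ℤ.*-identityʳ j)))) ⟩
  mkℚᵘ i 0 ℚᵘ.+ mkℚᵘ j 0               ≈⟨ ℚᵘ.+-cong (ℚᵘ.≃-sym (toℚᵘ-/ i 0)) (ℚᵘ.≃-sym (toℚᵘ-/ j 0)) ⟩
  ℚ.toℚᵘ (i / 1) ℚᵘ.+ ℚ.toℚᵘ (j / 1)   ≈⟨ ℚᵘ.≃-sym (toℚᵘ-homo-+ (i / 1) (j / 1)) ⟩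
  ℚ.toℚᵘ (i / 1 ℚ.+ j / 1)             ∎)
  where open ℚᵘ.≃-Reasoning

/1-homo-* : ∀ i j → (i ℤ.* j) / 1 ≡ (i / 1) ℚ.* (j / 1)
/1-homo-* i j = toℚᵘ-injective (begin
  ℚ.toℚᵘ ((i ℤ.* j) / 1)               ≈⟨ toℚᵘ-/ (i ℤ.* j) 0 ⟩
  mkℚᵘ (i ℤ.* j) 0                     ≈⟨ *≡* refl ⟩
  mkℚᵘ i 0 ℚᵘ.* mkℚᵘ j 0               ≈⟨ ℚᵘ.*-cong (ℚᵘ.≃-sym (toℚᵘ-/ i 0)) (ℚᵘ.≃-sym (toℚᵘ-/ j 0)) ⟩
  ℚ.toℚᵘ (i / 1) ℚᵘ.* ℚ.toℚᵘ (j / 1)   ≈⟨ ℚᵘ.≃-sym (toℚᵘ-homo-* (i / 1) (j / 1)) ⟩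
  ℚ.toℚᵘ ((i / 1) ℚ.* (j / 1))         ∎)
  where open ℚᵘ.≃-Reasoning

/1-mono-≤ : ∀ {i j} → i ℤ.≤ j → i / 1 ℚ.≤ j / 1
/1-mono-≤ {i} {j} i≤j = toℚᵘ-cancel-≤
  (ℚᵘ.≤-respˡ-≃ (ℚᵘ.≃-sym (toℚᵘ-/ i 0)) (ℚᵘ.≤-respʳ-≃ (ℚᵘ.≃-sym (toℚᵘ-/ j 0))
    (*≤* (subst₂ ℤ._≤_ (sym (ℤ.*-identityʳ i)) (sym (ℤ.*-identityʳ j)) i≤j))))

/1-cancel-< : ∀ {i j} → i / 1 ℚ.< j / 1 → i ℤ.< j
/1-cancel-< {i} {j} lt
  with ℚᵘ.<-respˡ-≃ (toℚᵘ-/ i 0) (ℚᵘ.<-respʳ-≃ (toℚᵘ-/ j 0) (toℚᵘ-mono-< lt))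
... | *<* i*1<j*1 = subst₂ ℤ._<_ (ℤ.*-identityʳ i) (ℤ.*-identityʳ j) i*1<j*1

/-*-cancel : ∀ i n .{{_ : ℕ.NonZero n}} → (i / n) ℚ.* ℕtoℚ n ≡ i / 1
/-*-cancel i (suc n) = toℚᵘ-injective (begin
  ℚ.toℚᵘ ((i / suc n) ℚ.* ℕtoℚ (suc n))            ≈⟨ toℚᵘ-homo-* (i / suc n) (ℕtoℚ (suc n)) ⟩
  ℚ.toℚᵘ (i / suc n) ℚᵘ.* ℚ.toℚᵘ (ℕtoℚ (suc n))    ≈⟨ ℚᵘ.*-cong (toℚᵘ-/ i n) (toℚᵘ-/ (+ suc n) 0) ⟩
  mkℚᵘ i n ℚᵘ.* mkℚᵘ (+ suc n) 0                   ≈⟨ *≡* (trans (ℤ.*-identityʳ _) (cong (λ k → i ℤ.* + k) (sym (ℕ.*-identityʳ (suc n))))) ⟩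
  mkℚᵘ i 0                                         ≈⟨ ℚᵘ.≃-sym (toℚᵘ-/ i 0) ⟩
  ℚ.toℚᵘ (i / 1)                                   ∎)
  where open ℚᵘ.≃-Reasoning

ℕtoℚ-+ : ∀ a b → ℕtoℚ (a + b) ≡ ℕtoℚ a ℚ.+ ℕtoℚ b
ℕtoℚ-+ a b = trans (cong (_/ 1) (ℤ.pos-+ a b)) (/1-homo-+ (+ a) (+ b))

ℕtoℚ-* : ∀ a b → ℕtoℚ (a * b) ≡ ℕtoℚ a ℚ.* ℕtoℚ b
ℕtoℚ-* a b = trans (cong (_/ 1) (ℤ.pos-* a b)) (/1-homo-* (+ a) (+ b))

ℕtoℚ-mono-≤ : ∀ {a b} → a ≤ b → ℕtoℚ a ℚ.≤ ℕtoℚ b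
ℕtoℚ-mono-≤ a≤b = /1-mono-≤ (ℤ.+≤+ a≤b)

ℕtoℚ-cancel-< : ∀ {a b} → ℕtoℚ a ℚ.< ℕtoℚ b → a ℕ.< b
ℕtoℚ-cancel-< lt = ℤ.drop‿+<+ (/1-cancel-< lt)

ℕtoℚ-nonNeg : ∀ n → 0ℚ ℚ.≤ ℕtoℚ n
ℕtoℚ-nonNeg n = ℕtoℚ-mono-≤ {0} {n} z≤n

ℕtoℚ-pos : ∀ n .{{_ : ℕ.NonZero n}} → ℚ.Positive (ℕtoℚ n)
ℕtoℚ-pos n = normalize-pos n 1

Odd : ℕ → Set
Odd n = ∃ λ h → n ≡ suc (2 * h)

even-or-odd : ∀ n → (∃ λ h → n ≡ 2 * h) ⊎ Odd n
even-or-odd zero = inj₁ (0 , refl)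
even-or-odd (suc n) with even-or-odd n
... | inj₁ (h , n≡2h)   = inj₂ (h , cong suc n≡2h)
... | inj₂ (h , n≡1+2h) = inj₁ (suc h , trans (cong suc n≡1+2h) (sym (ℕ.*-suc 2 h)))

prime⇒odd : ∀ {q} → Prime q → 3 ≤ q → Odd q
prime⇒odd {q} pr 3≤q with even-or-odd q
... | inj₂ odd      = odd
... | inj₁ (h , q≡2h) =
  ⊥-elim (prime⇒¬composite pr (composite {2} 3≤q (divides h (trans q≡2h (ℕ.*-comm 2 h)))))

sum-of-odds : ∀ xs → All Odd xs → ∃ λ t → sum xs ≡ length xs + 2 * t
sum-of-odds [] [] = 0 , refl
sum-of-odds (x ∷ xs) ((h , refl) ∷ odds) with sum-of-odds xs odds
... | t , sum≡ = h + t , (begin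
  suc (2 * h) + sum xs                ≡⟨ cong (λ s → suc (2 * h) + s) sum≡ ⟩
  suc (2 * h) + (length xs + 2 * t)   ≡⟨ cong suc (rearrange h (length xs) t) ⟩
  suc (length xs + 2 * (h + t))       ∎)
  where
  open ≡-Reasoning
  rearrange : ∀ h k t → 2 * h + (k + 2 * t) ≡ k + 2 * (h + t)
  rearrange = ℕ-Ring.solve-∀

length*≤sum : ∀ p xs → All (p ≤_) xs → length xs * p ≤ sum xs
length*≤sum p [] [] = z≤n
length*≤sum p (x ∷ xs) (p≤x ∷ bounds) = ℕ.+-mono-≤ p≤x (length*≤sum p xs bounds)

sum≤length* : ∀ B xs → All (λ x → ℕtoℚ x ℚ.≤ B) xs → ℕtoℚ (sum xs) ℚ.≤ ℕtoℚ (length xs) ℚ.* B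
sum≤length* B [] [] = ≤-reflexive (sym (*-zeroˡ B))
sum≤length* B (x ∷ xs) (x≤B ∷ bounds) = begin
  ℕtoℚ (x + sum xs)                     ≡⟨ ℕtoℚ-+ x (sum xs) ⟩
  ℕtoℚ x ℚ.+ ℕtoℚ (sum xs)              ≤⟨ +-mono-≤ x≤B (sum≤length* B xs bounds) ⟩
  B ℚ.+ ℕtoℚ (length xs) ℚ.* B          ≡⟨ one-more B (ℕtoℚ (length xs)) ⟩
  (1ℚ ℚ.+ ℕtoℚ (length xs)) ℚ.* B       ≡⟨ cong (ℚ._* B) (sym (ℕtoℚ-+ 1 (length xs))) ⟩
  ℕtoℚ (suc (length xs)) ℚ.* B          ∎
  where
  open ≤-Reasoning
  one-more : ∀ B k → B ℚ.+ k ℚ.* B ≡ (1ℚ ℚ.+ k) ℚ.* B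
  one-more = solve-∀ ℚ-ring

narrow-interval : ∀ lam p {q} → lam ℚ.* ℕtoℚ p ℚ.< 1ℚ → InI lam p q → q ≡ p
narrow-interval lam p {q} λp<1 (_ , p≤q , q≤p+λp) = ℕ.≤-antisym (ℕ.≤-pred q<1+p) p≤q
  where
  open ≤-Reasoning
  q<1+p : q ℕ.< suc p
  q<1+p = ℕtoℚ-cancel-< (begin-strict
    ℕtoℚ q                       ≤⟨ q≤p+λp ⟩
    ℕtoℚ p ℚ.+ lam ℚ.* ℕtoℚ p    <⟨ +-monoʳ-< (ℕtoℚ p) λp<1 ⟩
    ℕtoℚ p ℚ.+ 1ℚ                ≡⟨ +-comm (ℕtoℚ p) 1ℚ ⟩
    1ℚ ℚ.+ ℕtoℚ p                ≡⟨ ℕtoℚ-+ 1 p ⟨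
    ℕtoℚ (suc p)                 ∎)

narrow⇒∉D : ∀ lam p → lam ℚ.* ℕtoℚ p ℚ.< 1ℚ → ¬ InD lam p
narrow⇒∉D lam p λp<1 (_ , q₁ , q₂ , q₁≢q₂ , q₁∈I , q₂∈I) =
  q₁≢q₂ (trans (narrow-interval lam p λp<1 q₁∈I) (sym (narrow-interval lam p λp<1 q₂∈I)))

-- Under the hypotheses of the proposition the prime 2 is not in D_λ:
-- 2(2 − λm) > 2 gives λm < 1, and then 2λ ≤ λm < 1.
two∉D : ∀ {lam m} → 0ℚ ℚ.≤ lam → 2 ≤ m →
        ℕtoℚ 2 ℚ.< ℕtoℚ 2 ℚ.* (ℕtoℚ 2 ℚ.- lam ℚ.* ℕtoℚ m) → ¬ InD lam 2
two∉D {lam} {m} lam≥0 m≥2 2<2d = narrow⇒∉D lam 2 (begin-strict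
  lam ℚ.* ℕtoℚ 2   ≤⟨ *-monoˡ-≤-nonNeg lam {{ℚ.nonNegative lam≥0}} (ℕtoℚ-mono-≤ m≥2) ⟩
  lam ℚ.* ℕtoℚ m   <⟨ λm<1 ⟩
  1ℚ               ∎)
  where
  open ≤-Reasoning
  1<d : 1ℚ ℚ.< ℕtoℚ 2 ℚ.- lam ℚ.* ℕtoℚ m
  1<d = *-cancelˡ-<-nonNeg (ℕtoℚ 2) {{ℚ.nonNegative (ℕtoℚ-nonNeg 2)}} 2<2d
  complement : ∀ x → (ℕtoℚ 2 ℚ.- x) ℚ.+ x ≡ 1ℚ ℚ.+ 1ℚ
  complement = solve-∀ ℚ-ring
  λm<1 : lam ℚ.* ℕtoℚ m ℚ.< 1ℚ
  λm<1 = +-cancelˡ-< 1ℚ (begin-strict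
    1ℚ ℚ.+ lam ℚ.* ℕtoℚ m                            ≡⟨ +-comm 1ℚ (lam ℚ.* ℕtoℚ m) ⟩
    lam ℚ.* ℕtoℚ m ℚ.+ 1ℚ                            <⟨ +-monoʳ-< (lam ℚ.* ℕtoℚ m) 1<d ⟩
    lam ℚ.* ℕtoℚ m ℚ.+ (ℕtoℚ 2 ℚ.- lam ℚ.* ℕtoℚ m)   ≡⟨ +-comm (lam ℚ.* ℕtoℚ m) _ ⟩
    (ℕtoℚ 2 ℚ.- lam ℚ.* ℕtoℚ m) ℚ.+ lam ℚ.* ℕtoℚ m   ≡⟨ complement (lam ℚ.* ℕtoℚ m) ⟩
    1ℚ ℚ.+ 1ℚ                                       ∎)

-- The gap condition for λ, m and p: m terms from I_λ(p) sum to at most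
-- m(p + λp), and this is less than (m+2)p − 2.
GapCondition : ℚ → ℕ → ℕ → Set
GapCondition lam m p =
  ℕtoℚ m ℚ.* (ℕtoℚ p ℚ.+ lam ℚ.* ℕtoℚ p) ℚ.+ ℕtoℚ 2 ℚ.< ℕtoℚ ((m + 2) * p)

gap-condition : ∀ lam m p →
  ℕtoℚ 2 ℚ.< ℕtoℚ p ℚ.* (ℕtoℚ 2 ℚ.- lam ℚ.* ℕtoℚ m) → GapCondition lam m p
gap-condition lam m p 2<pd = begin-strict
  M ℚ.* B ℚ.+ ℕtoℚ 2                                <⟨ +-monoʳ-< (M ℚ.* B) 2<pd ⟩
  M ℚ.* B ℚ.+ P ℚ.* (ℕtoℚ 2 ℚ.- lam ℚ.* M)           ≡⟨ rearrange M P lam ⟩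
  (M ℚ.+ ℕtoℚ 2) ℚ.* P                              ≡⟨ cong (ℚ._* P) (ℕtoℚ-+ m 2) ⟨
  ℕtoℚ (m + 2) ℚ.* P                                ≡⟨ ℕtoℚ-* (m + 2) p ⟨
  ℕtoℚ ((m + 2) * p)                                ∎
  where
  open ≤-Reasoning
  M = ℕtoℚ m
  P = ℕtoℚ p
  B = P ℚ.+ lam ℚ.* P
  rearrange : ∀ M P l → M ℚ.* (P ℚ.+ l ℚ.* P) ℚ.+ P ℚ.* (ℕtoℚ 2 ℚ.- l ℚ.* M) ≡ (M ℚ.+ ℕtoℚ 2) ℚ.* P
  rearrange = solve-∀ ℚ-ring

few-terms : ∀ lam m p xs → 0ℚ ℚ.≤ lam → GapCondition lam m p →
            All (InI lam p) xs → length xs ≤ m → sum xs + 2 ℕ.< (m + 2) * p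
few-terms lam m p xs lam≥0 gap xs⊆I k≤m = ℕtoℚ-cancel-< (begin-strict
  ℕtoℚ (sum xs + 2)                        ≡⟨ ℕtoℚ-+ (sum xs) 2 ⟩
  ℕtoℚ (sum xs) ℚ.+ ℕtoℚ 2                 ≤⟨ +-monoˡ-≤ (ℕtoℚ 2) (sum≤length* B xs (All.map upper xs⊆I)) ⟩
  ℕtoℚ (length xs) ℚ.* B ℚ.+ ℕtoℚ 2        ≤⟨ +-monoˡ-≤ (ℕtoℚ 2) (*-monoʳ-≤-nonNeg B (ℕtoℚ-mono-≤ k≤m)) ⟩
  ℕtoℚ m ℚ.* B ℚ.+ ℕtoℚ 2                  <⟨ gap ⟩
  ℕtoℚ ((m + 2) * p)                       ∎)
  where
  open ≤-Reasoning
  P = ℕtoℚ p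
  B = P ℚ.+ lam ℚ.* P
  upper : ∀ {q} → InI lam p q → ℕtoℚ q ℚ.≤ B
  upper (_ , _ , q≤B) = q≤B
  instance
    B-nonNeg : ℚ.NonNegative B
    B-nonNeg = nonNeg+nonNeg⇒nonNeg P {{ℚ.nonNegative (ℕtoℚ-nonNeg p)}} (lam ℚ.* P)
                 {{nonNeg*nonNeg⇒nonNeg lam {{ℚ.nonNegative lam≥0}} P {{ℚ.nonNegative (ℕtoℚ-nonNeg p)}}}}

-- m + 1 odd terms have a sum of the parity of m + 1, while (m+2)p − 2 has
-- the parity of m when p is odd
odd-terms : ∀ m p xs → Odd p → All Odd xs → length xs ≡ suc m → sum xs + 2 ≢ (m + 2) * p
odd-terms m p xs (h , refl) odds k≡1+m sum+2≡ with sum-of-odds xs odds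
... | t , sum≡ = ℕ.even≢odd ((m + 2) * h) t (ℕ.+-cancelˡ-≡ (m + 2) _ _ (begin
  (m + 2) + 2 * ((m + 2) * h)     ≡⟨ expand-left m h ⟩
  (m + 2) * suc (2 * h)           ≡⟨ sum+2≡ ⟨
  sum xs + 2                      ≡⟨ cong (_+ 2) sum≡ ⟩
  length xs + 2 * t + 2           ≡⟨ cong (λ k → k + 2 * t + 2) k≡1+m ⟩
  suc m + 2 * t + 2               ≡⟨ expand-right m t ⟩
  (m + 2) + suc (2 * t)           ∎))
  where
  open ≡-Reasoning
  expand-left : ∀ m h → (m + 2) + 2 * ((m + 2) * h) ≡ (m + 2) * (1 + 2 * h)
  expand-left = ℕ-Ring.solve-∀
  expand-right : ∀ m t → 1 + m + 2 * t + 2 ≡ (m + 2) + (1 + 2 * t)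
  expand-right = ℕ-Ring.solve-∀

no-representation : ∀ lam m p xs → 0ℚ ℚ.≤ lam → 3 ≤ p → Odd p → GapCondition lam m p →
                    All (InI lam p) xs → sum xs + 2 ≢ (m + 2) * p
no-representation lam m p xs lam≥0 p≥3 p-odd gap xs⊆I sum+2≡
  with ℕ.<-cmp (length xs) (suc m)
... | tri< k<1+m _ _ =
  ℕ.<-irrefl sum+2≡ (few-terms lam m p xs lam≥0 gap xs⊆I (ℕ.≤-pred k<1+m))
... | tri≈ _ k≡1+m _ =
  odd-terms m p xs p-odd (All.map (λ (q-prime , p≤q , _) → prime⇒odd q-prime (ℕ.≤-trans p≥3 p≤q)) xs⊆I)
            k≡1+m sum+2≡
... | tri> _ _ 2+m≤k = ℕ.<⇒≱ sum<[m+2]p [m+2]p≤sum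
  where
  sum<[m+2]p : sum xs ℕ.< (m + 2) * p
  sum<[m+2]p = subst (sum xs ℕ.<_) sum+2≡ (ℕ.m<m+n (sum xs) (s≤s z≤n))
  [m+2]p≤sum : (m + 2) * p ≤ sum xs
  [m+2]p≤sum = ℕ.≤-trans (ℕ.*-monoˡ-≤ p (subst (_≤ length xs) (ℕ.+-comm 2 m) 2+m≤k))
                         (length*≤sum p xs (All.map (λ (_ , p≤q , _) → p≤q) xs⊆I))

gap⇒nonrepresentable : ∀ lam m p N → 0ℚ ℚ.≤ lam → 3 ≤ p → Odd p →
  GapCondition lam m p → N + 2 ≡ (m + 2) * p → ¬ Representable lam p (+ N)
gap⇒nonrepresentable lam m p N lam≥0 p≥3 p-odd gap N+2≡ (xs , xs⊆I , +N≡+sum) =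
  no-representation lam m p xs lam≥0 p≥3 p-odd gap xs⊆I
    (trans (cong (_+ 2) (sym (ℤ.+-injective +N≡+sum))) N+2≡)

nonrepresentable≤F : ∀ lam p {F n} → IsFrobeniusNumber lam p F → ¬ Representable lam p n → n ℤ.≤ F
nonrepresentable≤F lam p {F} {n} (_ , above-F) n-nonrep with n ℤ.≤? F
... | yes n≤F = n≤F
... | no  n≰F = ⊥-elim (n-nonrep (above-F n (ℤ.≰⇒> n≰F)))

ratio-bound : ∀ m p N F .{{_ : ℕ.NonZero p}} → + N ℤ.≤ F → N + 2 ≡ (m + 2) * p →
              ℕtoℚ (m + 2) ℚ.- (+ 2 / p) ℚ.≤ F / p
ratio-bound m p N F N≤F N+2≡ = *-cancelʳ-≤-pos P {{ℕtoℚ-pos p}} (begin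
  (ℕtoℚ (m + 2) ℚ.- (+ 2 / p)) ℚ.* P               ≡⟨ distrib (ℕtoℚ (m + 2)) (+ 2 / p) P ⟩
  ℕtoℚ (m + 2) ℚ.* P ℚ.- (+ 2 / p) ℚ.* P           ≡⟨ cong₂ ℚ._-_ (sym (ℕtoℚ-* (m + 2) p)) (/-*-cancel (+ 2) p) ⟩
  ℕtoℚ ((m + 2) * p) ℚ.- ℕtoℚ 2                    ≡⟨ cong (λ x → ℕtoℚ x ℚ.- ℕtoℚ 2) N+2≡ ⟨
  ℕtoℚ (N + 2) ℚ.- ℕtoℚ 2                          ≡⟨ cong (ℚ._- ℕtoℚ 2) (ℕtoℚ-+ N 2) ⟩
  (ℕtoℚ N ℚ.+ ℕtoℚ 2) ℚ.- ℕtoℚ 2                   ≡⟨ add-sub (ℕtoℚ N) (ℕtoℚ 2) ⟩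
  ℕtoℚ N                                           ≤⟨ /1-mono-≤ N≤F ⟩
  F / 1                                            ≡⟨ /-*-cancel F p ⟨
  (F / p) ℚ.* P                                    ∎)
  where
  open ≤-Reasoning
  P = ℕtoℚ p
  distrib : ∀ a b c → (a ℚ.- b) ℚ.* c ≡ a ℚ.* c ℚ.- b ℚ.* c
  distrib = solve-∀ ℚ-ring
  add-sub : ∀ a b → (a ℚ.+ b) ℚ.- b ≡ a
  add-sub = solve-∀ ℚ-ring

<-/⇒*< : ∀ {lam} i n .{{_ : ℕ.NonZero n}} → lam ℚ.< i / n → lam ℚ.* ℕtoℚ n ℚ.< i / 1
<-/⇒*< i n lt = subst (_ ℚ.<_) (/-*-cancel i n) (*-monoˡ-<-pos (ℕtoℚ n) {{ℕtoℚ-pos n}} lt)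

÷<⇒<* : ∀ {x y d} .{{_ : NonZero d}} → 0ℚ ℚ.< d → y ÷ d ℚ.< x → y ℚ.< x ℚ.* d
÷<⇒<* {x} {y} {d} d>0 lt = subst (ℚ._< x ℚ.* d) ÷-*-cancel (*-monoˡ-<-pos d {{ℚ.positive d>0}} lt)
  where
  open ≡-Reasoning
  ÷-*-cancel : (y ÷ d) ℚ.* d ≡ y
  ÷-*-cancel = begin
    (y ℚ.* ℚ.1/ d) ℚ.* d   ≡⟨ *-assoc y (ℚ.1/ d) d ⟩
    y ℚ.* (ℚ.1/ d ℚ.* d)   ≡⟨ cong (y ℚ.*_) (*-inverseˡ d) ⟩
    y ℚ.* 1ℚ               ≡⟨ *-identityʳ y ⟩
    y                      ∎

prime≢2⇒≥3 : ∀ {p} → Prime p → p ≢ 2 → 3 ≤ p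
prime≢2⇒≥3 {suc (suc zero)} _ p≢2 = ⊥-elim (p≢2 refl)
prime≢2⇒≥3 {suc (suc (suc _))} _ _ = s≤s (s≤s (s≤s z≤n))

proposition2p4 : (m : ℕ) → (m≥2 : 2 ≤ m) → (lam : ℚ) → 0ℚ ℚ.< lam
    → lam ℚ.< (+ 2 / m) {{ℕ.>-nonZero (≤-trans (s≤s z≤n) m≥2)}}
    → (p : ℕ) → (pr : Prime p) → InD lam p
    → .{{nz : NonZero (ℕtoℚ 2 ℚ.- lam ℚ.* ℕtoℚ m)}}
    → ℕtoℚ p ℚ.> ℕtoℚ 2 ÷ (ℕtoℚ 2 ℚ.- lam ℚ.* ℕtoℚ m)
    → (F : ℤ) → IsFrobeniusNumber lam p F
    → (F / p) {{prime⇒nonZero pr}} ℚ.≥ ℕtoℚ (m + 2) ℚ.- (+ 2 / p) {{prime⇒nonZero pr}}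
proposition2p4 m m≥2 lam lam>0 lam<2/m p pr p∈D p>2/d F F-frob =
  ratio-bound m p N F (nonrepresentable≤F lam p F-frob N-nonrep) N+2≡
  where
  instance
    m-nonZero : ℕ.NonZero m
    m-nonZero = ℕ.>-nonZero (≤-trans (s≤s z≤n) m≥2)
    p-nonZero : ℕ.NonZero p
    p-nonZero = prime⇒nonZero pr
  lam≥0 : 0ℚ ℚ.≤ lam
  lam≥0 = <⇒≤ lam>0
  2<pd : ℕtoℚ 2 ℚ.< ℕtoℚ p ℚ.* (ℕtoℚ 2 ℚ.- lam ℚ.* ℕtoℚ m)
  2<pd = ÷<⇒<* (<⇒0<- (<-/⇒*< (+ 2) m lam<2/m)) p>2/d
  p≥3 : 3 ≤ p
  p≥3 = prime≢2⇒≥3 pr λ { refl → two∉D lam≥0 m≥2 2<pd p∈D }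
  N : ℕ
  N = (m + 2) * p ∸ 2
  N+2≡ : N + 2 ≡ (m + 2) * p
  N+2≡ = ℕ.m∸n+n≡m (ℕ.≤-trans (ℕ.m≤n+m 2 m) (ℕ.m≤m*n (m + 2) p))
  N-nonrep : ¬ Representable lam p (+ N)
  N-nonrep = gap⇒nonrepresentable lam m p N lam≥0 p≥3 (prime⇒odd pr p≥3)
               (gap-condition lam m p 2<pd) N+2≡
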